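{- Let $L,R$ be nonempty subsets of a group $G$ and $s\in G$. In $2\mathrm{S}(G;L,R)$, if $g=w_{\bar{L},m,a}\,s\,w_{\bar{R},n,b}$, then $g\sim l^ds$ and $g\sim sr^d$ for every $l\in L$ and every $r\in R$, where $d=m+n-(a+b)$.
   Context: For a group $G$ and nonempty subsets $L,R\subseteq G$, the two-sided group digraph $2\mathrm{S}(G;L,R)$ has vertex set $G$ and a directed arc $(g,h)$ if and only if $h=l^{ -1}gr$ for some $l\in L$, $r\in R$. We write $g\sim h$ ($g$ weakly connected to $h$) if there is a sequence $g=g_0,\dots,g_k=h$ such that for each $i$ either $(g_{i-1},g_i)$ or $(g_i,g_{i-1})$ is an arc. $w_{\bar{L},m,a}$ denotes a product of $m+a$ factors, $m$ of which are elements of $L$ and $a$ of which are inverses of elements of $L$, in any order; similarly $w_{\bar{R},n,b}$ is a product of $n$ elements of $R$ and $b$ inverses of elements of $R$ in any order ($m,a,n,b\in\mathbb{N}$). -}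

module Defs where

open import Level using (Level; _⊔_)
open import Algebra.Bundles using (Group)
open import Data.Nat using (ℕ; zero; suc)
open import Data.Integer using (ℤ; +_; -[1+_])
open import Data.Product using (∃; ∃₂; _×_; _,_)
open import Data.Sum using (_⊎_)
open import Relation.Unary using (Pred; _∈_)

module GroupDigraph {c ℓ : Level} (G : Group c ℓ) where
  open Group G

  _^ℕ_ : Carrier → ℕ → Carrier
  x ^ℕ zero  = ε
  x ^ℕ suc n = x ∙ (x ^ℕ n)

  _^ℤ_ : Carrier → ℤ → Carrier
  x ^ℤ (+ n)     = x ^ℕ n
  x ^ℤ -[1+ n ]  = (x ⁻¹) ^ℕ suc n

  module _ {p q : Level} (L : Pred Carrier p) (R : Pred Carrier q) where

    Arc : Carrier → Carrier → Set (c ⊔ ℓ ⊔ p ⊔ q)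
    Arc g h = ∃₂ λ l r → l ∈ L × r ∈ R × h ≈ (l ⁻¹ ∙ g) ∙ r

    data _∼_ (g : Carrier) : Carrier → Set (c ⊔ ℓ ⊔ p ⊔ q) where
      here : ∀ {h} → g ≈ h → g ∼ h
      step : ∀ {h h'} → g ∼ h → (Arc h h' ⊎ Arc h' h) → g ∼ h'

  data Word {p : Level} (S : Pred Carrier p) : ℕ → ℕ → Carrier → Set (c ⊔ p) where
    nil  : Word S 0 0 ε
    cons : ∀ {m a w x} → x ∈ S → Word S m a w → Word S (suc m) a (x ∙ w)
    consInv : ∀ {m a w x} → x ∈ S → Word S m a w → Word S m (suc a) (x ⁻¹ ∙ w)

module Submission where

open import Defs
open import Level using (Level)
open import Level using (_⊔_)
open import Algebra.Bundles using (Group)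
open import Data.Nat using (ℕ) renaming (_+_ to _+ℕ_)
open import Data.Integer using (+_; _-_)
open import Data.Product using (∃; _×_)
open import Relation.Unary using (Pred; _∈_)

open import Data.Nat using (zero; suc)
open import Data.Integer using (ℤ; -[1+_]; _+_; -_)
open import Data.Integer.Properties using (+-assoc; +-identityˡ; +-identityʳ)
open import Data.Integer.Tactic.RingSolver using (solve-∀)
open import Data.Product using (∃₂; _,_)
open import Data.Sum using (inj₁; inj₂)
open import Relation.Binary.PropositionalEquality as ≡ using (_≡_)
open import Relation.Binary.Structures using (IsPreorder)
import Algebra.Properties.Group as GroupProperties
import Relation.Binary.Reasoning.Setoid as SetoidReasoning
import Relation.Binary.Reasoning.Base.Double as PreorderReasoning

-- Every arc of 2S(G;L,R) gives two elementary moves inside a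
-- weak component: for l ∈ L and r ∈ R,
--     l ∙ x  ∼  x ∙ r        and        l⁻¹ ∙ x  ∼  x ∙ r⁻¹ .
-- Pushing the letters of a word over L one by one through y turns each
-- letter into r or r⁻¹, so w ∙ y ∼ y ∙ r^(m-a) for w = w_{L̄,m,a}
-- ("left word transfer"); symmetrically x ∙ w ∼ l^(n-b) ∙ x for a word over R.
-- Since l^j is itself a word over L of net exponent j, this also gives
-- l^j ∙ z ∼ z ∙ r^j.  For g = w_L s w_R we then move w_R to the left as
-- l^(n-b), move that across w_L s to the right as r^(n-b), and finally move
-- w_L to the right as r^(m-a); the exponent law r^i r^j = r^(i+j) collects
-- s ∙ r^d.  The statement for l^d s follows from l^d ∙ s ∼ s ∙ r^d.

net : ℕ → ℕ → ℤ
net m a = + m - + a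

net-suc : ∀ m a → net (suc m) a ≡ + 1 + net m a
net-suc m a = +-assoc (+ 1) (+ m) (- (+ a))

net-sucInv : ∀ m a → net m (suc a) ≡ -[1+ 0 ] + net m a
net-sucInv m a = lemma (+ m) (+ a)
  where
  lemma : ∀ M A → M - (+ 1 + A) ≡ -[1+ 0 ] + (M - A)
  lemma = solve-∀

net-+ : ∀ m a n b → net n b + net m a ≡ net (m +ℕ n) (a +ℕ b)
net-+ m a n b = lemma (+ m) (+ a) (+ n) (+ b)
  where
  lemma : ∀ M A N B → (N - B) + (M - A) ≡ (M + N) - (A + B)
  lemma = solve-∀

module Powers {c ℓ : Level} (G : Group c ℓ) where
  open Group G
  open GroupDigraph G
  open GroupProperties G using (\\-leftDividesˡ; \\-leftDividesʳ)
  open SetoidReasoning setoid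

  pow-suc : ∀ x k → x ∙ x ^ℤ k ≈ x ^ℤ (+ 1 + k)
  pow-suc x (+ n)           = refl
  pow-suc x -[1+ zero ]     = \\-leftDividesˡ x ε
  pow-suc x -[1+ suc n ]    = \\-leftDividesˡ x ((x ⁻¹) ^ℕ suc n)

  pow-pred : ∀ x k → x ⁻¹ ∙ x ^ℤ k ≈ x ^ℤ (-[1+ 0 ] + k)
  pow-pred x (+ zero)   = refl
  pow-pred x (+ suc n)  = \\-leftDividesʳ x (x ^ℕ n)
  pow-pred x -[1+ n ]   = refl

  pow-+ : ∀ x i j → x ^ℤ i ∙ x ^ℤ j ≈ x ^ℤ (i + j)
  pow-+ x (+ zero) j = begin
    ε ∙ x ^ℤ j        ≈⟨ identityˡ _ ⟩
    x ^ℤ j            ≡⟨ ≡.cong (x ^ℤ_) (≡.sym (+-identityˡ j)) ⟩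
    x ^ℤ (+ 0 + j)    ∎
  pow-+ x (+ suc n) j = begin
    (x ∙ x ^ℕ n) ∙ x ^ℤ j      ≈⟨ assoc _ _ _ ⟩
    x ∙ (x ^ℤ (+ n) ∙ x ^ℤ j)  ≈⟨ ∙-congˡ (pow-+ x (+ n) j) ⟩
    x ∙ x ^ℤ (+ n + j)         ≈⟨ pow-suc x (+ n + j) ⟩
    x ^ℤ (+ 1 + (+ n + j))     ≡⟨ ≡.cong (x ^ℤ_) (≡.sym (+-assoc (+ 1) (+ n) j)) ⟩
    x ^ℤ (+ suc n + j)         ∎
  pow-+ x -[1+ zero ] j = begin
    (x ⁻¹ ∙ ε) ∙ x ^ℤ j        ≈⟨ ∙-congʳ (identityʳ _) ⟩
    x ⁻¹ ∙ x ^ℤ j              ≈⟨ pow-pred x j ⟩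
    x ^ℤ (-[1+ 0 ] + j)        ∎
  pow-+ x -[1+ suc n ] j = begin
    (x ⁻¹ ∙ x ^ℤ -[1+ n ]) ∙ x ^ℤ j    ≈⟨ assoc _ _ _ ⟩
    x ⁻¹ ∙ (x ^ℤ -[1+ n ] ∙ x ^ℤ j)    ≈⟨ ∙-congˡ (pow-+ x -[1+ n ] j) ⟩
    x ⁻¹ ∙ x ^ℤ (-[1+ n ] + j)         ≈⟨ pow-pred x (-[1+ n ] + j) ⟩
    x ^ℤ (-[1+ 0 ] + (-[1+ n ] + j))   ≡⟨ ≡.cong (x ^ℤ_) (≡.sym (+-assoc -[1+ 0 ] -[1+ n ] j)) ⟩
    x ^ℤ (-[1+ suc n ] + j)            ∎

  powerWord : ∀ {p} {S : Pred Carrier p} {x} → x ∈ S → ∀ j →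
              ∃₂ λ m a → Word S m a (x ^ℤ j) × net m a ≡ j
  powerWord {S = S} {x} x∈S (+ n)     = n , 0 , positive n , +-identityʳ (+ n)
    where
    positive : ∀ n → Word S n 0 (x ^ℕ n)
    positive zero    = nil
    positive (suc n) = cons x∈S (positive n)
  powerWord {S = S} {x} x∈S -[1+ n ]  = 0 , suc n , negative (suc n) , ≡.refl
    where
    negative : ∀ n → Word S 0 n ((x ⁻¹) ^ℕ n)
    negative zero    = nil
    negative (suc n) = consInv x∈S (negative n)

module Connectivity {c ℓ p q : Level} (G : Group c ℓ)
                    (L : Pred (Group.Carrier G) p) (R : Pred (Group.Carrier G) q) where
  open Group G
  open GroupDigraph G renaming (_∼_ to WeaklyConnected)
  open GroupProperties G using (\\-leftDividesʳ; //-rightDividesˡ)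
  open Powers G

  infix 4 _∼_
  _∼_ : Carrier → Carrier → Set (c ⊔ ℓ ⊔ p ⊔ q)
  _∼_ = WeaklyConnected L R

  ∼-respʳ : ∀ {g h k} → g ∼ h → h ≈ k → g ∼ k
  ∼-respʳ (here g≈h)                                 h≈k = here (trans g≈h h≈k)
  ∼-respʳ (step g∼h (inj₁ (l , r , l∈L , r∈R , e))) h≈k =
    step g∼h (inj₁ (l , r , l∈L , r∈R , trans (sym h≈k) e))
  ∼-respʳ (step g∼h (inj₂ (l , r , l∈L , r∈R , e))) h≈k =
    step g∼h (inj₂ (l , r , l∈L , r∈R , trans e (∙-congʳ (∙-congˡ h≈k))))

  ∼-trans : ∀ {g h k} → g ∼ h → h ∼ k → g ∼ k
  ∼-trans g∼h (here h≈k)      = ∼-respʳ g∼h h≈k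
  ∼-trans g∼h (step h∼k arc)  = step (∼-trans g∼h h∼k) arc

  ∼-sym : ∀ {g h} → g ∼ h → h ∼ g
  ∼-sym (here g≈h)            = here (sym g≈h)
  ∼-sym (step g∼h (inj₁ arc)) = ∼-trans (step (here refl) (inj₂ arc)) (∼-sym g∼h)
  ∼-sym (step g∼h (inj₂ arc)) = ∼-trans (step (here refl) (inj₁ arc)) (∼-sym g∼h)

  ∼-isPreorder : IsPreorder _≈_ _∼_
  ∼-isPreorder = record { isEquivalence = isEquivalence ; reflexive = here ; trans = ∼-trans }

  shift : ∀ {l r} → l ∈ L → r ∈ R → ∀ x → l ∙ x ∼ x ∙ r
  shift {l} {r} l∈L r∈R x =
    step (here refl) (inj₁ (l , r , l∈L , r∈R , ∙-congʳ (sym (\\-leftDividesʳ l x))))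

  shiftInv : ∀ {l r} → l ∈ L → r ∈ R → ∀ x → l ⁻¹ ∙ x ∼ x ∙ r ⁻¹
  shiftInv {l} {r} l∈L r∈R x = step (here refl) (inj₂ (l , r , l∈L , r∈R , arc))
    where
    arc : l ⁻¹ ∙ x ≈ (l ⁻¹ ∙ (x ∙ r ⁻¹)) ∙ r
    arc = trans (∙-congˡ (sym (//-rightDividesˡ r x))) (sym (assoc _ _ _))

  open PreorderReasoning ∼-isPreorder

  leftWordTransfer : ∀ {r} → r ∈ R → ∀ {m a w} → Word L m a w →
                     ∀ y → w ∙ y ∼ y ∙ r ^ℤ net m a
  leftWordTransfer {r} r∈R nil y = begin
    ε ∙ y        ≈⟨ identityˡ y ⟩
    y            ≈⟨ identityʳ y ⟨
    y ∙ ε        ∎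
  leftWordTransfer {r} r∈R (cons {m} {a} {w} {l} l∈L word) y = begin
    (l ∙ w) ∙ y                 ≈⟨ assoc _ _ _ ⟩
    l ∙ (w ∙ y)                 ≲⟨ shift l∈L r∈R (w ∙ y) ⟩
    (w ∙ y) ∙ r                 ≈⟨ assoc _ _ _ ⟩
    w ∙ (y ∙ r)                 ≲⟨ leftWordTransfer r∈R word (y ∙ r) ⟩
    (y ∙ r) ∙ r ^ℤ net m a      ≈⟨ assoc _ _ _ ⟩
    y ∙ (r ∙ r ^ℤ net m a)      ≈⟨ ∙-congˡ (pow-suc r (net m a)) ⟩
    y ∙ r ^ℤ (+ 1 + net m a)    ≡⟨ ≡.cong (λ k → y ∙ r ^ℤ k) (net-suc m a) ⟨
    y ∙ r ^ℤ net (suc m) a      ∎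
  leftWordTransfer {r} r∈R (consInv {m} {a} {w} {l} l∈L word) y = begin
    (l ⁻¹ ∙ w) ∙ y                   ≈⟨ assoc _ _ _ ⟩
    l ⁻¹ ∙ (w ∙ y)                   ≲⟨ shiftInv l∈L r∈R (w ∙ y) ⟩
    (w ∙ y) ∙ r ⁻¹                   ≈⟨ assoc _ _ _ ⟩
    w ∙ (y ∙ r ⁻¹)                   ≲⟨ leftWordTransfer r∈R word (y ∙ r ⁻¹) ⟩
    (y ∙ r ⁻¹) ∙ r ^ℤ net m a        ≈⟨ assoc _ _ _ ⟩
    y ∙ (r ⁻¹ ∙ r ^ℤ net m a)        ≈⟨ ∙-congˡ (pow-pred r (net m a)) ⟩
    y ∙ r ^ℤ (-[1+ 0 ] + net m a)    ≡⟨ ≡.cong (λ k → y ∙ r ^ℤ k) (net-sucInv m a) ⟨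
    y ∙ r ^ℤ net m (suc a)           ∎

  rightWordTransfer : ∀ {l} → l ∈ L → ∀ {n b w} → Word R n b w →
                      ∀ x → x ∙ w ∼ l ^ℤ net n b ∙ x
  rightWordTransfer {l} l∈L nil x = begin
    x ∙ ε        ≈⟨ identityʳ x ⟩
    x            ≈⟨ identityˡ x ⟨
    ε ∙ x        ∎
  rightWordTransfer {l} l∈L (cons {n} {b} {w} {r} r∈R word) x = begin
    x ∙ (r ∙ w)                 ≈⟨ assoc _ _ _ ⟨
    (x ∙ r) ∙ w                 ≲⟨ rightWordTransfer l∈L word (x ∙ r) ⟩
    l ^ℤ net n b ∙ (x ∙ r)      ≈⟨ assoc _ _ _ ⟨
    (l ^ℤ net n b ∙ x) ∙ r      ≲⟨ ∼-sym (shift l∈L r∈R (l ^ℤ net n b ∙ x)) ⟩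
    l ∙ (l ^ℤ net n b ∙ x)      ≈⟨ assoc _ _ _ ⟨
    (l ∙ l ^ℤ net n b) ∙ x      ≈⟨ ∙-congʳ (pow-suc l (net n b)) ⟩
    l ^ℤ (+ 1 + net n b) ∙ x    ≡⟨ ≡.cong (λ k → l ^ℤ k ∙ x) (net-suc n b) ⟨
    l ^ℤ net (suc n) b ∙ x      ∎
  rightWordTransfer {l} l∈L (consInv {n} {b} {w} {r} r∈R word) x = begin
    x ∙ (r ⁻¹ ∙ w)                   ≈⟨ assoc _ _ _ ⟨
    (x ∙ r ⁻¹) ∙ w                   ≲⟨ rightWordTransfer l∈L word (x ∙ r ⁻¹) ⟩
    l ^ℤ net n b ∙ (x ∙ r ⁻¹)        ≈⟨ assoc _ _ _ ⟨
    (l ^ℤ net n b ∙ x) ∙ r ⁻¹        ≲⟨ ∼-sym (shiftInv l∈L r∈R (l ^ℤ net n b ∙ x)) ⟩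
    l ⁻¹ ∙ (l ^ℤ net n b ∙ x)        ≈⟨ assoc _ _ _ ⟨
    (l ⁻¹ ∙ l ^ℤ net n b) ∙ x        ≈⟨ ∙-congʳ (pow-pred l (net n b)) ⟩
    l ^ℤ (-[1+ 0 ] + net n b) ∙ x    ≡⟨ ≡.cong (λ k → l ^ℤ k ∙ x) (net-sucInv n b) ⟨
    l ^ℤ net n (suc b) ∙ x           ∎

  powerTransfer : ∀ {l r} → l ∈ L → r ∈ R → ∀ j z → l ^ℤ j ∙ z ∼ z ∙ r ^ℤ j
  powerTransfer {l} {r} l∈L r∈R j z with powerWord l∈L j
  ... | m , a , word , ≡.refl = leftWordTransfer r∈R word z

  towardsR : ∀ {l r} → l ∈ L → r ∈ R → ∀ {s g wL wR m a n b} →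
             Word L m a wL → Word R n b wR → g ≈ (wL ∙ s) ∙ wR →
             g ∼ s ∙ r ^ℤ net (m +ℕ n) (a +ℕ b)
  towardsR {l} {r} l∈L r∈R {s} {g} {wL} {wR} {m} {a} {n} {b} WL WR g≈ = begin
    g                                       ≈⟨ g≈ ⟩
    (wL ∙ s) ∙ wR                           ≲⟨ rightWordTransfer l∈L WR (wL ∙ s) ⟩
    l ^ℤ net n b ∙ (wL ∙ s)                 ≲⟨ powerTransfer l∈L r∈R (net n b) (wL ∙ s) ⟩
    (wL ∙ s) ∙ r ^ℤ net n b                 ≈⟨ assoc _ _ _ ⟩
    wL ∙ (s ∙ r ^ℤ net n b)                 ≲⟨ leftWordTransfer r∈R WL (s ∙ r ^ℤ net n b) ⟩
    (s ∙ r ^ℤ net n b) ∙ r ^ℤ net m a       ≈⟨ assoc _ _ _ ⟩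
    s ∙ (r ^ℤ net n b ∙ r ^ℤ net m a)       ≈⟨ ∙-congˡ (pow-+ r (net n b) (net m a)) ⟩
    s ∙ r ^ℤ (net n b + net m a)            ≡⟨ ≡.cong (λ k → s ∙ r ^ℤ k) (net-+ m a n b) ⟩
    s ∙ r ^ℤ net (m +ℕ n) (a +ℕ b)          ∎

-- Lemma 4.2: g ∼ l^d s and g ∼ s r^d for all l ∈ L, r ∈ R, d = m + n - (a + b).
-- Each half uses the nonemptiness of the opposite set to run the transfers.
lemma4p2 : ∀ {c ℓ p q : Level} (G : Group c ℓ) →
  (L : Pred (Group.Carrier G) p) (R : Pred (Group.Carrier G) q) →
  (∃ λ x → x ∈ L) → (∃ λ y → y ∈ R) →
  (s g wL wR : Group.Carrier G) (m a n b : ℕ) →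
  GroupDigraph.Word G L m a wL → GroupDigraph.Word G R n b wR →
  Group._≈_ G g (Group._∙_ G (Group._∙_ G wL s) wR) →
  (∀ l → l ∈ L → GroupDigraph._∼_ G L R g
      (Group._∙_ G (GroupDigraph._^ℤ_ G l ((+ (m +ℕ n)) - (+ (a +ℕ b)))) s)) ×
  (∀ r → r ∈ R → GroupDigraph._∼_ G L R g
      (Group._∙_ G s (GroupDigraph._^ℤ_ G r ((+ (m +ℕ n)) - (+ (a +ℕ b))))))
lemma4p2 G L R (l₀ , l₀∈L) (r₀ , r₀∈R) s g wL wR m a n b WL WR g≈ =
  (λ l l∈L → ∼-trans (towardsR l∈L r₀∈R WL WR g≈)
                     (∼-sym (powerTransfer l∈L r₀∈R (net (m +ℕ n) (a +ℕ b)) s))) ,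
  (λ r r∈R → towardsR l₀∈L r∈R WL WR g≈)
  where open Connectivity G L R
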